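{- Let $p$ be a prime and let $G$ be an extra special group of order $p^{2n+1}$, i.e. $G$ is one of the two groups $H_n$ or $M_n$ described in the context. For every $\varepsilon>0$ there exists a positive integer $n_0=n_0(\varepsilon)$ such that if $n\ge n_0$, $B\subseteq G$ is a brick and $|B|>|G|^{3/4+\varepsilon}$, then $B\cdot B=\{bb': b,b'\in B\}$ contains at least $|B|/p$ cosets of the center $G'=[\vec 0,\vec 0,\mathbb{F}_p]=\{[\vec 0,\vec 0,z]:z\in\mathbb{F}_p\}$ of $G$ (a nontrivial subgroup).
   Context: An extra special group is a $p$-group whose center $Z(G)$ is cyclic of order $p$ and such that $G/Z(G)$ is elementary abelian; such groups have order $p^{2n+1}$, and for each $n\ge1$ there are exactly two up to isomorphism, $H_n$ and $M_n$. Concretely, both are realized on triples $[\vec{x},\vec{y},z]$ with $\vec{x},\vec{y}\in\mathbb{F}_p^n$, $z\in\mathbb{F}_p$: in $H_n$ (the Heisenberg group) the product is $[\vec{x},\vec{y},z]\cdot[\vec{x}',\vec{y}',z']=[\vec{x}+\vec{x}',\vec{y}+\vec{y}',z+z'+\langle\vec{x},\vec{y}'\rangle]$, and in $M_n$ it is $[\vec{x}+\vec{x}',\vec{y}+\vec{y}',z+z'+\langle\vec{x},\vec{y}'\rangle+f(\vec{y},\vec{y}')]$, where $\langle\vec{x},\vec{y}'\rangle=\sum_i x_iy_i'$ and $f(\vec{y},\vec{y}')=\sum_{i=1}^n\lfloor ((y_i\bmod p)+(y_i'\bmod p))/p\rfloor$, with $y\bmod p\in\{0,\dots,p-1\}$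 denoting $y\in\mathbb{F}_p$ regarded as an integer. In either coordinatization, a brick is a set $B=\{[\vec{x},\vec{y},z]: \vec{x}\in X_1\times\dots\times X_n,\ \vec{y}\in Y_1\times\dots\times Y_n,\ z\in Z\}$ with nonempty subsets $X_i,Y_i,Z\subseteq\mathbb{F}_p$. -}

module Defs where

open import Data.Nat using (ℕ; zero; suc; _+_; _*_; _^_; _<_; _≤_; NonZero)
open import Data.Nat.DivMod using (_mod_; _div_)
open import Data.Nat.Primality using (Prime; prime⇒nonZero)
open import Data.Fin using (Fin; toℕ)
open import Data.Fin.Subset using (Subset; ∣_∣; Nonempty) renaming (_∈_ to _∈ₛ_)
open import Data.Vec using (Vec; lookup; replicate; zipWith; foldr)
open import Data.Product using (Σ; ∃; _×_; _,_)
open import Relation.Binary.PropositionalEquality using (_≡_)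

data Kind : Set where
  Heis : Kind
  Mtyp : Kind

module ES (p : ℕ) (pr : Prime p) where

  private
    instance
      nz : NonZero p
      nz = prime⇒nonZero pr

  Fp : Set
  Fp = Fin p

  ⟦_⟧ : ℕ → Fp
  ⟦ m ⟧ = m mod p

  sumV : ∀ {n} → Vec ℕ n → ℕ
  sumV = foldr _ _+_ 0

  -- <x , y'> = Σ x_i y'_i  (as a natural number, reduced mod p later)
  inner : ∀ {n} → Vec Fp n → Vec Fp n → ℕ
  inner x y = sumV (zipWith (λ a b → toℕ a * toℕ b) x y)

  carry : ∀ {n} → Vec Fp n → Vec Fp n → ℕ
  carry y y' = sumV (zipWith (λ a b → (toℕ a + toℕ b) div p) y y')

  record Elem (n : ℕ) : Set where
    constructor [_,_,_]
    field
      xs : Vec Fp n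
      ys : Vec Fp n
      zc : Fp
  open Elem public

  addV : ∀ {n} → Vec Fp n → Vec Fp n → Vec Fp n
  addV = zipWith (λ a b → ⟦ toℕ a + toℕ b ⟧)

  mul : ∀ {n} → Kind → Elem n → Elem n → Elem n
  mul Heis [ x , y , z ] [ x' , y' , z' ] =
    [ addV x x' , addV y y' , ⟦ toℕ z + toℕ z' + inner x y' ⟧ ]
  mul Mtyp [ x , y , z ] [ x' , y' , z' ] =
    [ addV x x' , addV y y' , ⟦ toℕ z + toℕ z' + inner x y' + carry y y' ⟧ ]

  order : ℕ → ℕ
  order n = p ^ (2 * n + 1)

  centerElem : ∀ {n} → Fp → Elem n
  centerElem c = [ replicate _ ⟦ 0 ⟧ , replicate _ ⟦ 0 ⟧ , c ]

  InCoset : ∀ {n} → Kind → Elem n → Elem n → Set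
  InCoset k h g = ∃ λ (c : Fp) → h ≡ mul k g (centerElem c)

  record Brick (n : ℕ) : Set where
    field
      X : Fin n → Subset p
      Y : Fin n → Subset p
      Z : Subset p
      X-ne : ∀ i → Nonempty (X i)
      Y-ne : ∀ i → Nonempty (Y i)
      Z-ne : Nonempty Z
  open Brick public

  _∈B_ : ∀ {n} → Elem n → Brick n → Set
  g ∈B B = (∀ i → lookup (xs g) i ∈ₛ X B i)
         × (∀ i → lookup (ys g) i ∈ₛ Y B i)
         × (zc g ∈ₛ Z B)

  prodF : ∀ {n} → (Fin n → ℕ) → ℕ
  prodF {zero} f = 1
  prodF {suc n} f = f Fin.zero * prodF (λ i → f (Fin.suc i))

  size : ∀ {n} → Brick n → ℕ
  size B = prodF (λ i → ∣ X B i ∣) * prodF (λ i → ∣ Y B i ∣) * ∣ Z B ∣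

  _∈BB_ : ∀ {n} → Elem n → Kind × Brick n → Set
  g ∈BB (k , B) = ∃ λ b → ∃ λ b' → b ∈B B × b' ∈B B × mul k b b' ≡ g

  -- B·B contains at least m distinct cosets of the center:
  -- there are m representatives whose cosets are pairwise distinct and
  -- each coset is contained in B·B.  "at least |B|/p" means m·p ≥ |B|.
  ContainsCosets : ∀ {n} → Kind → Brick n → ℕ → Set
  ContainsCosets {n} k B m =
    Σ (Fin m → Elem n) λ r →
        (∀ i j → InCoset k (r i) (r j) → i ≡ j)
      × (∀ i (c : Fp) → mul k (r i) (centerElem c) ∈BB (k , B))

  -- |B| > |G|^(3/4 + a/b), i.e. |B|^(4b) > |G|^(3b + 4a)
  BigBrick : ∀ {n} → Brick n → ℕ → ℕ → Set
  BigBrick {n} B a b = order n ^ (3 * b + 4 * a) < size B ^ (4 * b)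

-- Choose, for every coordinate i, a design: sums s = x + x′ with x, x′ ∈ X_i, each written in two ways,
-- and a fixed β ∈ Y_i.  Then [x, y, z₀]·[x′, β, z₀] has x-part s, y-part y + β and central part
-- z₀ + z₀ + Σ x_i β_i plus a term not depending on the x's.  When at least p coordinates are flexible
-- (the two ways give different x_i β_i), these central parts cover F_p by the Cauchy–Davenport growth
-- argument, so B·B contains Π (number of sums at i)·|Y_i| whole cosets of the centre.
-- If p coordinates have X_i = F_p and a nonzero element in Y_i, writing j + 0 = (j + 1) + (−1) costs
-- nothing.  If many coordinates have 2 ≤ |X_i| < p, making p of them flexible by x + a = a + x (x ≠ a)
-- loses a factor 2 each, but every other such coordinate gains a sum outside X_i + a, which wins.
-- Otherwise all but boundedly many coordinates have |X_i||Y_i| ≤ p, and |B| ≤ p^(n+O(1)) ≤ |G|^(3/4).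

module Submission where

open import Defs
open import Data.Nat using (ℕ; _*_; _≤_; _<_)
open import Data.Nat.Primality using (Prime)
open import Data.Product using (Σ; _×_)

open import Data.Bool using (Bool; true; false; _∧_; not; if_then_else_)
open import Data.Fin as Fin using (Fin; zero; suc; toℕ; fromℕ<)
open import Data.Fin.Properties
  using (all?; any?; ¬∀⟶∃¬; injective⇒≤; toℕ-injective; toℕ-fromℕ<; toℕ<n; combine-remQuot; suc-injective)
open import Data.Fin.Subset using (Subset; ∣_∣; _-_; Nonempty; ⊤; ⁅_⁆) renaming (_∈_ to _∈ₛ_; _∉_ to _∉ₛ_)
open import Data.Fin.Subset.Properties
  using (_∈?_; ∈⊤; ∣p∣≤n; ∣p∣≡n⇒p≡⊤; ∣⊤∣≡n; p⊆q⇒∣p∣≤∣q∣; ∣p∣≤∣x∷p∣; p─⊥≡p; p─q⊆p; x∈⁅x⁆; ∣⁅x⁆∣≡1)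
open import Data.Nat
  using (zero; suc; _+_; _∸_; _^_; _⊓_; _<ᵇ_; pred; NonZero; >-nonZero; nonTrivial⇒n>1; z<s; s≤s; _≟_; _≤?_; _<?_)
open import Data.Nat.DivMod
  using ( _%_; _/_; m≡m%n+[m/n]*n; %-distribˡ-+; %-remove-+ʳ; m%n%n≡m%n; m<n⇒m%n≡m; m*n%n≡0; n%n≡0; m%n≤n; m%n<n
        ; m<n⇒m/n≡0)
open import Data.Nat.Divisibility using (_∣_; divides; n∣m⇒m%n≡0; ∣⇒≤)
open import Data.Nat.Primality using (euclidsLemma; prime⇒nonZero; prime⇒nonTrivial)
open import Data.Nat.Properties hiding (suc-injective)
open import Algebra.Properties.CommutativeMonoid.Sum +-0-commutativeMonoid
  using (sum; sum-cong-≗; ∑-distrib-+)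
open import Data.Nat.Solver using (module +-*-Solver)
open import Data.Product using (∃; _,_; proj₁; proj₂; uncurry)
open import Data.Sum using (_⊎_; inj₁; inj₂; [_,_]′)
open import Data.Vec using (Vec; []; _∷_; here; there; lookup; tabulate; replicate)
open import Data.Vec.Properties using (lookup∘tabulate; tabulate-cong)
open import Data.Vec.Functional using (tail) renaming (_∷_ to _◂_)
open import Function using (_∘_; id)
open import Function.Definitions using (Injective)
open import Relation.Nullary using (¬_; Dec; yes; no; contradiction; ¬?; _×-dec_)
open import Relation.Binary.PropositionalEquality
  using (_≡_; _≢_; refl; sym; trans; cong; cong₂; subst; module ≡-Reasoning)
import Algebra.Properties.CommutativeSemigroup as CommutativeSemigroupProperties

private
  module +-CS = CommutativeSemigroupProperties +-commutativeSemigroup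
  module *-CS = CommutativeSemigroupProperties *-commutativeSemigroup

module Congruence (d : ℕ) .{{_ : NonZero d}} where

  infix 4 _≡ₘ_

  _≡ₘ_ : ℕ → ℕ → Set
  m ≡ₘ n = m % d ≡ n % d

  neg : ℕ → ℕ
  neg m = d ∸ m % d

  %-≡ₘ : ∀ m → m % d ≡ₘ m
  %-≡ₘ m = m%n%n≡m%n m d

  +-cong-≡ₘ : ∀ {m m′ n n′} → m ≡ₘ m′ → n ≡ₘ n′ → m + n ≡ₘ m′ + n′
  +-cong-≡ₘ {m} {m′} {n} {n′} e f = begin
    (m + n) % d            ≡⟨ %-distribˡ-+ m n d ⟩
    (m % d + n % d) % d    ≡⟨ cong₂ (λ a b → (a + b) % d) e f ⟩
    (m′ % d + n′ % d) % d  ≡⟨ %-distribˡ-+ m′ n′ d ⟨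
    (m′ + n′) % d          ∎
    where open ≡-Reasoning

  +-inverseʳ-≡ₘ : ∀ m → m + neg m ≡ₘ 0
  +-inverseʳ-≡ₘ m = begin
    (m + neg m) % d      ≡⟨ +-cong-≡ₘ (sym (%-≡ₘ m)) refl ⟩
    (m % d + neg m) % d  ≡⟨ cong (_% d) (m+[n∸m]≡n (m%n≤n m d)) ⟩
    d % d                ≡⟨ n%n≡0 d ⟩
    0                    ≡⟨ m*n%n≡0 0 d ⟨
    0 % d                ∎
    where open ≡-Reasoning

  +-neg-cancelʳ-≡ₘ : ∀ m k → m + k + neg k ≡ₘ m
  +-neg-cancelʳ-≡ₘ m k = begin
    (m + k + neg k) % d    ≡⟨ cong (_% d) (+-assoc m k (neg k)) ⟩
    (m + (k + neg k)) % d  ≡⟨ +-cong-≡ₘ {m} refl (+-inverseʳ-≡ₘ k) ⟩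
    (m + 0) % d            ≡⟨ cong (_% d) (+-identityʳ m) ⟩
    m % d                  ∎
    where open ≡-Reasoning

  +-cancelʳ-≡ₘ : ∀ {m n} k → m + k ≡ₘ n + k → m ≡ₘ n
  +-cancelʳ-≡ₘ {m} {n} k e =
    trans (sym (+-neg-cancelʳ-≡ₘ m k)) (trans (+-cong-≡ₘ e (refl {x = neg k % d})) (+-neg-cancelʳ-≡ₘ n k))

  +-cancelˡ-≡ₘ : ∀ {m n} k → k + m ≡ₘ k + n → m ≡ₘ n
  +-cancelˡ-≡ₘ {m} {n} k e =
    +-cancelʳ-≡ₘ k (trans (cong (_% d) (+-comm m k)) (trans e (cong (_% d) (+-comm k n))))

  <-≡ₘ⇒≡ : ∀ {m n} → m < d → n < d → m ≡ₘ n → m ≡ n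
  <-≡ₘ⇒≡ m<d n<d e = trans (sym (m<n⇒m%n≡m m<d)) (trans e (m<n⇒m%n≡m n<d))

  ≡ₘ⇒∣∸ : ∀ {m n} → m ≤ n → m ≡ₘ n → d ∣ n ∸ m
  ≡ₘ⇒∣∸ {m} {n} m≤n e = divides (n / d ∸ m / d) (begin
    n ∸ m                                      ≡⟨ cong₂ _∸_ (m≡m%n+[m/n]*n n d) (m≡m%n+[m/n]*n m d) ⟩
    (n % d + n / d * d) ∸ (m % d + m / d * d)  ≡⟨ cong (λ r → (r + n / d * d) ∸ (m % d + m / d * d)) e ⟨
    (m % d + n / d * d) ∸ (m % d + m / d * d)  ≡⟨ [m+n]∸[m+o]≡n∸o (m % d) (n / d * d) (m / d * d) ⟩
    n / d * d ∸ m / d * d                      ≡⟨ *-distribʳ-∸ d (n / d) (m / d) ⟨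
    (n / d ∸ m / d) * d                        ∎)
    where open ≡-Reasoning

  ∣∸⇒≡ₘ : ∀ {m n} → m ≤ n → d ∣ n ∸ m → m ≡ₘ n
  ∣∸⇒≡ₘ {m} {n} m≤n d∣n∸m = sym (trans (cong (_% d) (sym (m+[n∸m]≡n m≤n))) (%-remove-+ʳ m d∣n∸m))

  ∣+neg⇒≡ₘ : ∀ {a b} → d ∣ b + neg a → a ≡ₘ b
  ∣+neg⇒≡ₘ {a} {b} d∣b+neg[a] = begin
    a % d                ≡⟨ +-cong-≡ₘ {m′ = 0} (trans (n∣m⇒m%n≡0 _ d d∣b+neg[a]) (sym (m*n%n≡0 0 d))) refl ⟨
    (b + neg a + a) % d  ≡⟨ cong (_% d) (+-CS.xy∙z≈xz∙y b (neg a) a) ⟩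
    (b + a + neg a) % d  ≡⟨ +-neg-cancelʳ-≡ₘ b a ⟩
    b % d                ∎
    where open ≡-Reasoning

  *-cancelʳ-≡ₘ : Prime d → ∀ {m n k} → ¬ d ∣ k → m * k ≡ₘ n * k → m ≡ₘ n
  *-cancelʳ-≡ₘ d-prime {m} {n} {k} d∤k e =
    [ (λ m≤n → ordered m≤n e) , (λ n≤m → sym (ordered n≤m (sym e))) ]′ (≤-total m n)
    where
    ordered : ∀ {m n} → m ≤ n → m * k ≡ₘ n * k → m ≡ₘ n
    ordered {m} {n} m≤n e = ∣∸⇒≡ₘ m≤n ([ id , (λ d∣k → contradiction d∣k d∤k) ]′
      (euclidsLemma (n ∸ m) k d-prime (subst (d ∣_) (sym (*-distribʳ-∸ k n m)) (≡ₘ⇒∣∸ (*-monoˡ-≤ k m≤n) e))))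

enum : ∀ {n} (S : Subset n) → Fin ∣ S ∣ → Fin n
enum (true ∷ S) zero = zero
enum (true ∷ S) (suc j) = suc (enum S j)
enum (false ∷ S) j = suc (enum S j)

enum-∈ : ∀ {n} (S : Subset n) j → enum S j ∈ₛ S
enum-∈ (true ∷ S) zero = here
enum-∈ (true ∷ S) (suc j) = there (enum-∈ S j)
enum-∈ (false ∷ S) j = there (enum-∈ S j)

enum-injective : ∀ {n} (S : Subset n) → Injective _≡_ _≡_ (enum S)
enum-injective (true ∷ S) {zero} {zero} e = refl
enum-injective (true ∷ S) {suc i} {suc j} e = cong suc (enum-injective S (suc-injective e))
enum-injective (false ∷ S) e = enum-injective S (suc-injective e)

x∉p-x : ∀ {n} (S : Subset n) x → x ∉ₛ S - x
x∉p-x (_ ∷ S) (suc x) (there x∈S-x) = x∉p-x S x x∈S-x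

∣p∣≤1+∣p-x∣ : ∀ {n} (S : Subset n) x → ∣ S ∣ ≤ suc ∣ S - x ∣
∣p∣≤1+∣p-x∣ (true ∷ S) zero = s≤s (≤-reflexive (cong ∣_∣ (sym (p─⊥≡p S))))
∣p∣≤1+∣p-x∣ (false ∷ S) zero = m≤n⇒m≤1+n (≤-reflexive (cong ∣_∣ (sym (p─⊥≡p S))))
∣p∣≤1+∣p-x∣ (true ∷ S) (suc x) = s≤s (∣p∣≤1+∣p-x∣ S x)
∣p∣≤1+∣p-x∣ (false ∷ S) (suc x) = ∣p∣≤1+∣p-x∣ S x

∈⇒0<∣p∣ : ∀ {n} {S : Subset n} {x} → x ∈ₛ S → 0 < ∣ S ∣
∈⇒0<∣p∣ {S = true ∷ S} here = z<s
∈⇒0<∣p∣ {S = b ∷ S} (there x∈S) = ≤-trans (∈⇒0<∣p∣ x∈S) (∣p∣≤∣x∷p∣ b S)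

0<∣p∣⇒nonempty : ∀ {n} {S : Subset n} → 0 < ∣ S ∣ → Nonempty S
0<∣p∣⇒nonempty {S = S} 0<∣S∣ = enum S (fromℕ< 0<∣S∣) , enum-∈ S _

∣p∣≡n⇒∈ : ∀ {n} {S : Subset n} → ∣ S ∣ ≡ n → ∀ x → x ∈ₛ S
∣p∣≡n⇒∈ ∣S∣≡n x = subst (x ∈ₛ_) (sym (∣p∣≡n⇒p≡⊤ ∣S∣≡n)) ∈⊤

∣p∣<n⇒∉ : ∀ {n} {S : Subset n} → ∣ S ∣ < n → ∃ λ x → x ∉ₛ S
∣p∣<n⇒∉ {n} {S} ∣S∣<n with all? (_∈? S)
... | yes all∈S =
  contradiction (subst (_≤ ∣ S ∣) (∣⊤∣≡n n) (p⊆q⇒∣p∣≤∣q∣ {p = ⊤} (λ {x} _ → all∈S x))) (<⇒≱ ∣S∣<n)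
... | no ¬all∈S = ¬∀⟶∃¬ n _ (_∈? S) ¬all∈S

⊆⁅x⁆⇒∣p∣≤1 : ∀ {n} {S : Subset n} x → (∀ {y} → y ∈ₛ S → y ≡ x) → ∣ S ∣ ≤ 1
⊆⁅x⁆⇒∣p∣≤1 x S⊆x =
  subst (_ ≤_) (∣⁅x⁆∣≡1 x) (p⊆q⇒∣p∣≤∣q∣ (λ y∈S → subst (_∈ₛ ⁅ x ⁆) (sym (S⊆x y∈S)) (x∈⁅x⁆ x)))

tabulate-injective : ∀ {a} {A : Set a} {n} {f g : Fin n → A} → tabulate f ≡ tabulate g → ∀ i → f i ≡ g i
tabulate-injective {f = f} {g} e i =
  trans (sym (lookup∘tabulate f i)) (trans (cong (λ v → lookup v i) e) (lookup∘tabulate g i))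

remQuot-injective : ∀ {m} n {I J : Fin (m * n)} → Fin.remQuot {m} n I ≡ Fin.remQuot n J → I ≡ J
remQuot-injective {m} n {I} {J} e =
  trans (sym (combine-remQuot {m} n I)) (trans (cong (uncurry Fin.combine) e) (combine-remQuot {m} n J))

◂-injective : ∀ {a} {A : Set a} {m} {f : Fin m → A} {u} →
              Injective _≡_ _≡_ f → (∀ j → f j ≢ u) → Injective _≡_ _≡_ (u ◂ f)
◂-injective f-injective f≢u {zero} {zero} e = refl
◂-injective f-injective f≢u {zero} {suc j} e = contradiction (sym e) (f≢u j)
◂-injective f-injective f≢u {suc i} {zero} e = contradiction e (f≢u i)
◂-injective f-injective f≢u {suc i} {suc j} e = cong suc (f-injective e)

AtLeast : ∀ {a} {A : Set a} → ℕ → (A → Set) → Set a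
AtLeast {A = A} m R = Σ (Fin m → A) λ f → Injective _≡_ _≡_ f × (∀ j → R (f j))

count : ∀ {n} → (Fin n → Bool) → ℕ
count E = sum (λ i → if E i then 1 else 0)

count-cong : ∀ {n} {E E′ : Fin n → Bool} → (∀ i → E i ≡ E′ i) → count E ≡ count E′
count-cong e = sum-cong-≗ (λ i → cong (λ b → if b then 1 else 0) (e i))

first : ∀ {n} → ℕ → (Fin n → Bool) → Fin n → Bool
first b E zero = E zero ∧ (0 <ᵇ b)
first b E (suc i) = first (if E zero then pred b else b) (E ∘ suc) i

count-first : ∀ {n} b (E : Fin n → Bool) → count (λ i → E i ∧ first b E i) ≡ b ⊓ count E
count-first {zero} b E = sym (⊓-zeroʳ b)
count-first {suc n} b E with E zero | b
... | false | b = count-first b (E ∘ suc)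
... | true | zero = count-first 0 (E ∘ suc)
... | true | suc b = cong suc (count-first b (E ∘ suc))

count-¬first : ∀ {n} b (E : Fin n → Bool) → count (λ i → E i ∧ not (first b E i)) ≡ count E ∸ b
count-¬first {zero} b E = sym (0∸n≡0 b)
count-¬first {suc n} b E with E zero | b
... | false | b = count-¬first b (E ∘ suc)
... | true | zero = cong suc (count-¬first 0 (E ∘ suc))
... | true | suc b = count-¬first b (E ∘ suc)

module Extraspecial (p : ℕ) (pr : Prime p) where

  open ES p pr

  instance
    p≢0 : NonZero p
    p≢0 = prime⇒nonZero pr

  open Congruence p

  toℕ-⟦⟧ : ∀ m → toℕ ⟦ m ⟧ ≡ m % p
  toℕ-⟦⟧ m = toℕ-fromℕ< (m%n<n m p)

  toℕ-⟦⟧-≡ₘ : ∀ m → toℕ ⟦ m ⟧ ≡ₘ m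
  toℕ-⟦⟧-≡ₘ m = trans (cong (_% p) (toℕ-⟦⟧ m)) (%-≡ₘ m)

  ⟦⟧-injective : ∀ {m n} → ⟦ m ⟧ ≡ ⟦ n ⟧ → m ≡ₘ n
  ⟦⟧-injective {m} {n} e = trans (sym (toℕ-⟦⟧ m)) (trans (cong toℕ e) (toℕ-⟦⟧ n))

  ⟦⟧-cong : ∀ {m n} → m ≡ₘ n → ⟦ m ⟧ ≡ ⟦ n ⟧
  ⟦⟧-cong {m} {n} e = toℕ-injective (trans (toℕ-⟦⟧ m) (trans e (sym (toℕ-⟦⟧ n))))

  toℕ-≡ₘ-injective : ∀ {s t : Fp} → toℕ s ≡ₘ toℕ t → s ≡ t
  toℕ-≡ₘ-injective {s} {t} e = toℕ-injective (<-≡ₘ⇒≡ (toℕ<n s) (toℕ<n t) e)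

  ⟦toℕ⟧ : ∀ t → ⟦ toℕ t ⟧ ≡ t
  ⟦toℕ⟧ t = toℕ-≡ₘ-injective (toℕ-⟦⟧-≡ₘ (toℕ t))

  toℕ-⟦0⟧ : toℕ ⟦ 0 ⟧ ≡ 0
  toℕ-⟦0⟧ = trans (toℕ-⟦⟧ 0) (m*n%n≡0 0 p)

  0≢ₘ1 : ¬ 0 ≡ₘ 1
  0≢ₘ1 e = 0≢1+n (trans (sym (m*n%n≡0 0 p)) (trans e (m<n⇒m%n≡m (nonTrivial⇒n>1 p {{prime⇒nonTrivial pr}}))))

  0<toℕ⇒∤ : ∀ (t : Fp) → 0 < toℕ t → ¬ p ∣ toℕ t
  0<toℕ⇒∤ t t>0 p∣t = <⇒≱ (toℕ<n t) (∣⇒≤ {{>-nonZero t>0}} p∣t)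

  infixl 6 _⊕_

  _⊕_ : Fp → ℕ → Fp
  t ⊕ k = ⟦ toℕ t + k ⟧

  ⊕-cong : ∀ t {a b} → a ≡ₘ b → t ⊕ a ≡ t ⊕ b
  ⊕-cong t e = ⟦⟧-cong (+-cong-≡ₘ {toℕ t} refl e)

  ⊕-assoc : ∀ t a b → t ⊕ a ⊕ b ≡ t ⊕ (a + b)
  ⊕-assoc t a b =
    ⟦⟧-cong (trans (+-cong-≡ₘ (toℕ-⟦⟧-≡ₘ (toℕ t + a)) (refl {x = b % p})) (cong (_% p) (+-assoc (toℕ t) a b)))

  ⊕-identityʳ : ∀ t → t ⊕ 0 ≡ t
  ⊕-identityʳ t = trans (cong ⟦_⟧ (+-identityʳ (toℕ t))) (⟦toℕ⟧ t)

  ⊕-⟦0⟧ : ∀ t → t ⊕ toℕ ⟦ 0 ⟧ ≡ t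
  ⊕-⟦0⟧ t = trans (⊕-cong t (toℕ-⟦⟧-≡ₘ 0)) (⊕-identityʳ t)

  ⊕-neg : ∀ t a → t ⊕ a ⊕ neg a ≡ t
  ⊕-neg t a = trans (⊕-assoc t a (neg a)) (trans (⊕-cong t (+-inverseʳ-≡ₘ a)) (⊕-identityʳ t))

  ⊕-cancelʳ : ∀ {s t} k → s ⊕ k ≡ t ⊕ k → s ≡ t
  ⊕-cancelʳ k e = toℕ-≡ₘ-injective (+-cancelʳ-≡ₘ k (⟦⟧-injective e))

  -- Subset sums of two-element sets

  ⊕-escapes : (P : Fp → Set) → (∀ t → Dec (P t)) → ∀ {t₀ u s} → P t₀ → ¬ P u → ¬ p ∣ s →
              ∃ λ t → P t × ¬ P (t ⊕ s)
  ⊕-escapes P P? {t₀} {u} {s} Pt₀ ¬Pu p∤s with any? (λ t → P? t ×-dec ¬? (P? (t ⊕ s)))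
  ... | yes escape = escape
  ... | no ¬escape = contradiction (injective⇒≤ walk-injective) 1+n≰n
    where
    ⊕-closed : ∀ t → P t → P (t ⊕ s)
    ⊕-closed t Pt with P? (t ⊕ s)
    ... | yes Pt⊕s = Pt⊕s
    ... | no ¬Pt⊕s = contradiction (t , Pt , ¬Pt⊕s) ¬escape

    orbit : ℕ → Fp
    orbit j = t₀ ⊕ j * s

    orbit-P : ∀ j → P (orbit j)
    orbit-P zero = subst P (sym (⊕-identityʳ t₀)) Pt₀
    orbit-P (suc j) = subst P (trans (⊕-assoc t₀ (j * s) s) (cong (t₀ ⊕_) (+-comm (j * s) s)))
                              (⊕-closed (orbit j) (orbit-P j))

    orbit-injective : ∀ {i j} → i < p → j < p → orbit i ≡ orbit j → i ≡ j
    orbit-injective i<p j<p e = <-≡ₘ⇒≡ i<p j<p (*-cancelʳ-≡ₘ pr p∤s (+-cancelˡ-≡ₘ (toℕ t₀) (⟦⟧-injective e)))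

    walk-injective : Injective _≡_ _≡_ (u ◂ (orbit ∘ toℕ))
    walk-injective = ◂-injective (λ {i} {j} → toℕ-injective ∘ orbit-injective (toℕ<n i) (toℕ<n j))
                                 (λ j e → ¬Pu (subst P e (orbit-P (toℕ j))))

  InImage : ∀ {m} → (Fin m → Fp) → Fp → Set
  InImage f t = ∃ λ j → f j ≡ t

  inImage? : ∀ {m} (f : Fin m → Fp) t → Dec (InImage f t)
  inImage? f t = any? (λ j → f j Fin.≟ t)

  atLeast-≤ : ∀ {m} {R : Fp → Set} → AtLeast m R → m ≤ p
  atLeast-≤ (_ , f-injective , _) = injective⇒≤ f-injective

  atLeast-map : ∀ {m} {R R′ : Fp → Set} → (∀ {t} → R t → R′ t) → AtLeast m R → AtLeast m R′
  atLeast-map R⊆R′ (f , f-injective , Rf) = f , f-injective , R⊆R′ ∘ Rf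

  grow : ∀ {m s} {R R′ : Fp → Set} → ¬ p ∣ s → (∀ {t} → R t → R′ t) → (∀ {t} → R t → R′ (t ⊕ s)) →
         AtLeast (suc m) R → (∀ t → R′ t) ⊎ AtLeast (suc (suc m)) R′
  grow {s = s} {R′ = R′} p∤s R⊆R′ R⊕s⊆R′ (f , f-injective , Rf) with all? (inImage? f)
  ... | yes covered = inj₁ λ t → let (j , fj≡t) = covered t in subst R′ fj≡t (R⊆R′ (Rf j))
  ... | no ¬covered with ¬∀⟶∃¬ p (InImage f) (inImage? f) ¬covered
  ...   | u , u∉f with ⊕-escapes (InImage f) (inImage? f) (zero , refl) u∉f p∤s
  ...     | t , (j , fj≡t) , t⊕s∉f =
    inj₂ (t ⊕ s ◂ f , ◂-injective f-injective (λ i e → t⊕s∉f (i , e)) , R′-new)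
    where
    R′-new : ∀ i → R′ ((t ⊕ s ◂ f) i)
    R′-new zero = subst (λ x → R′ (x ⊕ s)) fj≡t (R⊕s⊆R′ (Rf j))
    R′-new (suc i) = R⊆R′ (Rf i)

  Reachable : ∀ {n} → (Fin n → Bool → ℕ) → ℕ → Fp → Set
  Reachable {n} c K t = ∃ λ (σ : Fin n → Bool) → ⟦ K + sum (λ i → c i (σ i)) ⟧ ≡ t

  reachable-◂ : ∀ {n} (c : Fin (suc n) → Bool → ℕ) b {K t} →
                Reachable (tail c) (K + c zero b) t → Reachable c K t
  reachable-◂ c b {K} (σ , e) = b ◂ σ , trans (cong ⟦_⟧ (sym (+-assoc K (c zero b) _))) e

  reachable-shift : ∀ {n} (c : Fin n → Bool → ℕ) K a b {t} →
                    Reachable c (K + a) t → Reachable c (K + b) (t ⊕ (b + neg a))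
  reachable-shift c K a b {t} (σ , e) = σ , ⟦⟧-cong (begin
    (K + b + S) % p                ≡⟨ +-neg-cancelʳ-≡ₘ (K + b + S) a ⟨
    (K + b + S + a + neg a) % p    ≡⟨ cong (_% p) (rearrange K a b S (neg a)) ⟩
    (K + a + S + (b + neg a)) % p  ≡⟨ +-cong-≡ₘ t≡ₘK+a+S refl ⟨
    (toℕ t + (b + neg a)) % p      ∎)
    where
    open ≡-Reasoning
    S = sum (λ i → c i (σ i))
    t≡ₘK+a+S : toℕ t ≡ₘ K + a + S
    t≡ₘK+a+S = trans (cong (λ x → toℕ x % p) (sym e)) (toℕ-⟦⟧-≡ₘ (K + a + S))
    rearrange : ∀ K a b S m → K + b + S + a + m ≡ K + a + S + (b + m)
    rearrange = solve 5 (λ K a b S m → K :+ b :+ S :+ a :+ m := K :+ a :+ S :+ (b :+ m)) refl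
      where open +-*-Solver

  reachable-spread : ∀ {n} (c : Fin n → Bool → ℕ) (E : Fin n → Bool) →
                     (∀ i → E i ≡ true → ¬ c i false ≡ₘ c i true) → ∀ K →
                     (∀ t → Reachable c K t) ⊎ AtLeast (suc (count E)) (Reachable c K)
  reachable-spread {zero} c E apart K =
    inj₂ ((λ _ → ⟦ K + 0 ⟧) , (λ { {zero} {zero} _ → refl }) , λ _ → (λ ()) , refl)
  reachable-spread {suc n} c E apart K
    with reachable-spread (tail c) (tail E) (apart ∘ suc) (K + c zero false)
  ... | inj₁ all = inj₁ (reachable-◂ c false ∘ all)
  ... | inj₂ spread with E zero in E₀
  ...   | false = inj₂ (atLeast-map (λ {t} → reachable-◂ c false {K} {t}) spread)
  ...   | true = grow {R = Reachable (tail c) (K + c zero false)}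
                      (apart zero E₀ ∘ ∣+neg⇒≡ₘ)
                      (λ {t} → reachable-◂ c false {K} {t})
                      (reachable-◂ c true ∘ reachable-shift (tail c) K (c zero false) (c zero true))
                      spread

  reachable-all : ∀ {n} (c : Fin n → Bool → ℕ) (E : Fin n → Bool) →
                  (∀ i → E i ≡ true → ¬ c i false ≡ₘ c i true) → p ≤ count E → ∀ K t → Reachable c K t
  reachable-all c E apart p≤count K t with reachable-spread c E apart K
  ... | inj₁ all = all t
  ... | inj₂ spread = contradiction p≤count (<⇒≱ (atLeast-≤ {R = Reachable c K} spread))

  prodF-* : ∀ {n} (f g : Fin n → ℕ) → prodF (λ i → f i * g i) ≡ prodF f * prodF g
  prodF-* {zero} f g = refl
  prodF-* {suc n} f g = trans (cong (f zero * g zero *_) (prodF-* (f ∘ suc) (g ∘ suc)))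
                              ([m*n]*[o*p]≡[m*o]*[n*p] (f zero) (g zero) (prodF (f ∘ suc)) (prodF (g ∘ suc)))

  prodF-mono : ∀ {n} {f g : Fin n → ℕ} → (∀ i → f i ≤ g i) → prodF f ≤ prodF g
  prodF-mono {zero} f≤g = ≤-refl
  prodF-mono {suc n} f≤g = *-mono-≤ (f≤g zero) (prodF-mono (f≤g ∘ suc))

  prodF-≤-^ : ∀ {n} m (f e : Fin n → ℕ) → (∀ i → f i ≤ m ^ suc (e i)) → prodF f ≤ m ^ (n + sum e)
  prodF-≤-^ {zero} m f e _ = ≤-refl
  prodF-≤-^ {suc n} m f e f≤ = begin
    f zero * prodF (f ∘ suc)                    ≤⟨ *-mono-≤ (f≤ zero) (prodF-≤-^ m _ (e ∘ suc) (f≤ ∘ suc)) ⟩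
    m ^ suc (e zero) * m ^ (n + sum (e ∘ suc))  ≡⟨ ^-distribˡ-+-* m (suc (e zero)) _ ⟨
    m ^ (suc (e zero) + (n + sum (e ∘ suc)))    ≡⟨ cong (λ k → m ^ suc k) (+-CS.x∙yz≈y∙xz (e zero) n _) ⟩
    m ^ (suc n + (e zero + sum (e ∘ suc)))      ∎
    where open ≤-Reasoning

  split : ∀ {n} (W : Fin n → ℕ) → Fin (prodF W) → (i : Fin n) → Fin (W i)
  split W I zero = proj₁ (Fin.remQuot {W zero} (prodF (W ∘ suc)) I)
  split W I (suc i) = split (W ∘ suc) (proj₂ (Fin.remQuot {W zero} (prodF (W ∘ suc)) I)) i

  split-injective : ∀ {n} (W : Fin n → ℕ) {I J} → (∀ i → split W I i ≡ split W J i) → I ≡ J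
  split-injective {zero} W {zero} {zero} e = refl
  split-injective {suc n} W e =
    remQuot-injective {W zero} (prodF (W ∘ suc)) (cong₂ _,_ (e zero) (split-injective (W ∘ suc) (e ∘ suc)))

  data Role : Set where
    plain lossy gain : Role

  isLossy isGain : Role → Bool
  isLossy lossy = true
  isLossy _ = false
  isGain gain = true
  isGain _ = false

  Fits : ℕ → Role → ℕ → ℕ → Set
  Fits q plain x w = x ≤ w
  Fits q lossy x w = x ≤ 2 * w
  Fits q gain x w = x < w × x ≤ q

  -- An integer form of (1 + 1/q)^G ≥ 1 + G/q, set against a factor 2 lost at each lossy coordinate.
  tradeoff : ∀ {n} q (x w : Fin n → ℕ) (r : Fin n → Role) → (∀ i → Fits q (r i) (x i) (w i)) →
             (q + count (isGain ∘ r)) * prodF x ≤ q * 2 ^ count (isLossy ∘ r) * prodF w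
  tradeoff {zero} q x w r fits = ≤-reflexive (cong (_* 1) (trans (+-identityʳ q) (sym (*-identityʳ q))))
  tradeoff {suc n} q x w r fits
    with r zero | fits zero | tradeoff q (x ∘ suc) (w ∘ suc) (r ∘ suc) (fits ∘ suc)
  ... | plain | x₀≤w₀ | ih = begin
      A * (x zero * P)      ≡⟨ *-CS.x∙yz≈y∙xz A (x zero) P ⟩
      x zero * (A * P)      ≤⟨ *-mono-≤ x₀≤w₀ ih ⟩
      w zero * (q * T * Q)  ≡⟨ *-CS.x∙yz≈y∙xz (w zero) (q * T) Q ⟩
      q * T * (w zero * Q)  ∎
    where
    open ≤-Reasoning
    A = q + count (isGain ∘ r ∘ suc) ; T = 2 ^ count (isLossy ∘ r ∘ suc)
    P = prodF (x ∘ suc) ; Q = prodF (w ∘ suc)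
  ... | lossy | x₀≤2w₀ | ih = begin
      A * (x zero * P)            ≡⟨ *-CS.x∙yz≈y∙xz A (x zero) P ⟩
      x zero * (A * P)            ≤⟨ *-mono-≤ x₀≤2w₀ ih ⟩
      2 * w zero * (q * T * Q)    ≡⟨ regroup q T (w zero) Q ⟩
      q * (2 * T) * (w zero * Q)  ∎
    where
    open ≤-Reasoning
    A = q + count (isGain ∘ r ∘ suc) ; T = 2 ^ count (isLossy ∘ r ∘ suc)
    P = prodF (x ∘ suc) ; Q = prodF (w ∘ suc)
    regroup : ∀ q t w Q → 2 * w * (q * t * Q) ≡ q * (2 * t) * (w * Q)
    regroup = solve 4 (λ q t w Q → con 2 :* w :* (q :* t :* Q) := q :* (con 2 :* t) :* (w :* Q)) refl
      where open +-*-Solver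
  ... | gain | (x₀<w₀ , x₀≤q) | ih = begin
      (q + suc G) * (x zero * P)     ≡⟨ cong (_* (x zero * P)) (+-suc q G) ⟩
      x zero * P + A * (x zero * P)  ≤⟨ +-mono-≤ (*-monoˡ-≤ P (≤-trans x₀≤q (m≤m+n q G)))
                                                 (≤-reflexive (*-CS.x∙yz≈y∙xz A (x zero) P)) ⟩
      A * P + x zero * (A * P)       ≤⟨ *-mono-≤ x₀<w₀ ih ⟩
      w zero * (q * T * Q)           ≡⟨ *-CS.x∙yz≈y∙xz (w zero) (q * T) Q ⟩
      q * T * (w zero * Q)           ∎
    where
    open ≤-Reasoning
    G = count (isGain ∘ r ∘ suc) ; A = q + G ; T = 2 ^ count (isLossy ∘ r ∘ suc)
    P = prodF (x ∘ suc) ; Q = prodF (w ∘ suc)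

  addV-tabulate : ∀ {n} (f g : Fin n → Fp) → addV (tabulate f) (tabulate g) ≡ tabulate (λ i → f i ⊕ toℕ (g i))
  addV-tabulate {zero} f g = refl
  addV-tabulate {suc n} f g = cong (f zero ⊕ toℕ (g zero) ∷_) (addV-tabulate (f ∘ suc) (g ∘ suc))

  inner-tabulate : ∀ {n} (f g : Fin n → Fp) →
                   inner (tabulate f) (tabulate g) ≡ sum (λ i → toℕ (f i) * toℕ (g i))
  inner-tabulate {zero} f g = refl
  inner-tabulate {suc n} f g = cong (toℕ (f zero) * toℕ (g zero) +_) (inner-tabulate (f ∘ suc) (g ∘ suc))

  addV-identityʳ : ∀ {n} (x : Vec Fp n) → addV x (replicate n ⟦ 0 ⟧) ≡ x
  addV-identityʳ [] = refl
  addV-identityʳ (a ∷ x) = cong₂ _∷_ (⊕-⟦0⟧ a) (addV-identityʳ x)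

  inner-zeroʳ : ∀ {n} (x : Vec Fp n) → inner x (replicate n ⟦ 0 ⟧) ≡ 0
  inner-zeroʳ [] = refl
  inner-zeroʳ (a ∷ x) = cong₂ _+_ (trans (cong (toℕ a *_) toℕ-⟦0⟧) (*-zeroʳ (toℕ a))) (inner-zeroʳ x)

  carry-zeroʳ : ∀ {n} (y : Vec Fp n) → carry y (replicate n ⟦ 0 ⟧) ≡ 0
  carry-zeroʳ [] = refl
  carry-zeroʳ (a ∷ y) = cong₂ _+_ (trans (cong (λ z → (toℕ a + z) / p) toℕ-⟦0⟧)
                                         (m<n⇒m/n≡0 (subst (_< p) (sym (+-identityʳ (toℕ a))) (toℕ<n a))))
                                  (carry-zeroʳ y)

  twist : ∀ {n} → Kind → Vec Fp n → Vec Fp n → ℕ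
  twist Heis y y′ = 0
  twist Mtyp y y′ = carry y y′

  twist-zeroʳ : ∀ {n} k (y : Vec Fp n) → twist k y (replicate n ⟦ 0 ⟧) ≡ 0
  twist-zeroʳ Heis y = refl
  twist-zeroʳ Mtyp y = carry-zeroʳ y

  elem-cong : ∀ {n} {x x′ y y′ : Vec Fp n} {z z′} →
              x ≡ x′ → y ≡ y′ → z ≡ z′ → [ x , y , z ] ≡ [ x′ , y′ , z′ ]
  elem-cong refl refl refl = refl

  mul-≡ : ∀ {n} k (x y x′ y′ : Vec Fp n) z z′ → mul k [ x , y , z ] [ x′ , y′ , z′ ] ≡
          [ addV x x′ , addV y y′ , ⟦ toℕ z + toℕ z′ + inner x y′ + twist k y y′ ⟧ ]
  mul-≡ Heis x y x′ y′ z z′ = elem-cong refl refl (cong ⟦_⟧ (sym (+-identityʳ _)))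
  mul-≡ Mtyp x y x′ y′ z z′ = refl

  mul-center : ∀ {n} k (x y : Vec Fp n) z c → mul k [ x , y , z ] (centerElem c) ≡ [ x , y , z ⊕ toℕ c ]
  mul-center k x y z c
    rewrite mul-≡ k x y (replicate _ ⟦ 0 ⟧) (replicate _ ⟦ 0 ⟧) z c
          | addV-identityʳ x | addV-identityʳ y | inner-zeroʳ x | twist-zeroʳ k y
          | +-identityʳ (toℕ z + toℕ c) | +-identityʳ (toℕ z + toℕ c) = refl

  -- Designs

  -- Row j of a design writes total j as left b j + right b j in two ways b ∈ Bool.  In B·B the row is
  -- realised by [left b j, y, z₀]·[right b j, β, z₀], whose central coordinate depends on b only through
  -- left b j · β; a flexible design moves it by a nonzero amount on every row.
  record Design (X Y : Subset p) : Set where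
    field
      width : ℕ
      total : Fin width → Fp
      total-injective : Injective _≡_ _≡_ total
      left right : Bool → Fin width → Fp
      left∈ : ∀ b j → left b j ∈ₛ X
      right∈ : ∀ b j → right b j ∈ₛ X
      left⊕right : ∀ b j → left b j ⊕ toℕ (right b j) ≡ total j
      β : Fp
      β∈ : β ∈ₛ Y
      flexible : Bool
      flexible-apart : flexible ≡ true → ∀ j → ¬ toℕ (left false j) * toℕ β ≡ₘ toℕ (left true j) * toℕ β

  open Design

  module Cosets {n} (k : Kind) (B : Brick n) (D : (i : Fin n) → Design (X B i) (Y B i)) where

    cells : Fin n → ℕ
    cells i = width (D i) * ∣ Y B i ∣

    Index : Set
    Index = Fin (prodF cells)

    row : Index → (i : Fin n) → Fin (width (D i))
    row I i = proj₁ (Fin.remQuot {width (D i)} ∣ Y B i ∣ (split cells I i))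

    col : Index → (i : Fin n) → Fin ∣ Y B i ∣
    col I i = proj₂ (Fin.remQuot {width (D i)} ∣ Y B i ∣ (split cells I i))

    y-left : Index → Fin n → Fp
    y-left I i = enum (Y B i) (col I i)

    y-right : Fin n → Fp
    y-right i = β (D i)

    x-rep y-rep : Index → Fin n → Fp
    x-rep I i = total (D i) (row I i)
    y-rep I i = y-left I i ⊕ toℕ (y-right i)

    rep : Index → Elem n
    rep I = [ tabulate (x-rep I) , tabulate (y-rep I) , ⟦ 0 ⟧ ]

    rep-distinct : ∀ I J → InCoset k (rep I) (rep J) → I ≡ J
    rep-distinct I J (c , e) = split-injective cells λ i →
      remQuot-injective {width (D i)} ∣ Y B i ∣
        (cong₂ _,_ (total-injective (D i) (tabulate-injective (cong xs rep≡) i))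
                   (enum-injective (Y B i) (⊕-cancelʳ _ (tabulate-injective (cong ys rep≡) i))))
      where
      rep≡ : rep I ≡ [ tabulate (x-rep J) , tabulate (y-rep J) , ⟦ 0 ⟧ ⊕ toℕ c ]
      rep≡ = trans e (mul-center k _ _ ⟦ 0 ⟧ c)

    z₀ : Fp
    z₀ = proj₁ (Z-ne B)

    base : Index → ℕ
    base I = toℕ z₀ + toℕ z₀ + twist k (tabulate (y-left I)) (tabulate y-right)

    weight : Index → Fin n → Bool → ℕ
    weight I i b = toℕ (left (D i) b (row I i)) * toℕ (β (D i))

    ∈-tabulate : ∀ {S : Fin n → Subset p} {f : Fin n → Fp} →
                 (∀ i → f i ∈ₛ S i) → ∀ i → lookup (tabulate f) i ∈ₛ S i
    ∈-tabulate {S} {f} f∈S i = subst (_∈ₛ S i) (sym (lookup∘tabulate f i)) (f∈S i)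

    module Factors (I : Index) (σ : Fin n → Bool) where

      x-left x-right : Fin n → Fp
      x-left i = left (D i) (σ i) (row I i)
      x-right i = right (D i) (σ i) (row I i)

      left-factor right-factor : Elem n
      left-factor = [ tabulate x-left , tabulate (y-left I) , z₀ ]
      right-factor = [ tabulate x-right , tabulate y-right , z₀ ]

      left-factor∈B : left-factor ∈B B
      left-factor∈B = ∈-tabulate (λ i → left∈ (D i) (σ i) (row I i)) ,
                      ∈-tabulate (λ i → enum-∈ (Y B i) (col I i)) , proj₂ (Z-ne B)

      right-factor∈B : right-factor ∈B B
      right-factor∈B = ∈-tabulate (λ i → right∈ (D i) (σ i) (row I i)) ,
                       ∈-tabulate (λ i → β∈ (D i)) , proj₂ (Z-ne B)

      left·right : mul k left-factor right-factor ≡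
                   [ tabulate (x-rep I) , tabulate (y-rep I) , ⟦ base I + sum (λ i → weight I i (σ i)) ⟧ ]
      left·right = begin
        mul k left-factor right-factor
          ≡⟨ mul-≡ k _ _ _ _ z₀ z₀ ⟩
        [ addV (tabulate x-left) (tabulate x-right) , addV (tabulate (y-left I)) (tabulate y-right) ,
          ⟦ toℕ z₀ + toℕ z₀ + inner (tabulate x-left) (tabulate y-right) + C ⟧ ]
          ≡⟨ elem-cong (trans (addV-tabulate x-left x-right)
                              (tabulate-cong λ i → left⊕right (D i) (σ i) (row I i)))
                       (addV-tabulate (y-left I) y-right)
                       (cong ⟦_⟧ (trans (cong (λ m → toℕ z₀ + toℕ z₀ + m + C) (inner-tabulate x-left y-right))
                                        (+-CS.xy∙z≈xz∙y (toℕ z₀ + toℕ z₀) _ C))) ⟩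
        [ tabulate (x-rep I) , tabulate (y-rep I) , ⟦ base I + sum (λ i → weight I i (σ i)) ⟧ ] ∎
        where
        open ≡-Reasoning
        C = twist k (tabulate (y-left I)) (tabulate y-right)

    coset⊆BB : p ≤ count (flexible ∘ D) → ∀ I t → [ tabulate (x-rep I) , tabulate (y-rep I) , t ] ∈BB (k , B)
    coset⊆BB p≤flexible I t
      with reachable-all (weight I) (flexible ∘ D) (λ i f → flexible-apart (D i) f (row I i)) p≤flexible (base I) t
    ... | σ , e =
      left-factor , right-factor , left-factor∈B , right-factor∈B , trans left·right (elem-cong refl refl e)
      where open Factors I σ

    containsCosets : p ≤ count (flexible ∘ D) → ContainsCosets k B (prodF cells)
    containsCosets p≤flexible = rep , rep-distinct ,
      λ I c → subst (_∈BB (k , B)) (sym (mul-center k _ _ ⟦ 0 ⟧ c)) (coset⊆BB p≤flexible I _)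

    size≤ : prodF (λ i → ∣ X B i ∣) ≤ prodF (width ∘ D) → size B ≤ prodF cells * p
    size≤ widths = begin
      prodF (λ i → ∣ X B i ∣) * prodF (λ i → ∣ Y B i ∣) * ∣ Z B ∣  ≤⟨ *-mono-≤ (*-monoˡ-≤ _ widths) (∣p∣≤n (Z B)) ⟩
      prodF (width ∘ D) * prodF (λ i → ∣ Y B i ∣) * p            ≡⟨ cong (_* p) (prodF-* (width ∘ D) _) ⟨
      prodF cells * p                                             ∎
      where open ≤-Reasoning

  plainDesign : ∀ {X Y} → Nonempty X → Nonempty Y → Design X Y
  plainDesign {X} (a , a∈X) (b , b∈Y) = record
    { width = ∣ X ∣ ; total = λ j → enum X j ⊕ toℕ a
    ; total-injective = λ e → enum-injective X (⊕-cancelʳ (toℕ a) e)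
    ; left = λ _ → enum X ; right = λ _ _ → a
    ; left∈ = λ _ → enum-∈ X ; right∈ = λ _ _ → a∈X
    ; left⊕right = λ _ _ → refl
    ; β = b ; β∈ = b∈Y ; flexible = false ; flexible-apart = λ () }

  shiftDesign : ∀ {X Y} → ∣ X ∣ ≡ p → ∀ {b} → b ∈ₛ Y → 0 < toℕ b → Design X Y
  shiftDesign ∣X∣≡p {b} b∈Y b>0 = record
    { width = p ; total = id ; total-injective = id
    ; left = λ { false j → j ; true j → j ⊕ 1 }
    ; right = λ { false _ → ⟦ 0 ⟧ ; true _ → ⟦ neg 1 ⟧ }
    ; left∈ = λ _ _ → ∣p∣≡n⇒∈ ∣X∣≡p _ ; right∈ = λ _ _ → ∣p∣≡n⇒∈ ∣X∣≡p _
    ; left⊕right = λ { false j → ⊕-⟦0⟧ j ; true j → trans (⊕-cong (j ⊕ 1) (toℕ-⟦⟧-≡ₘ (neg 1))) (⊕-neg j 1) }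
    ; β = b ; β∈ = b∈Y ; flexible = true
    ; flexible-apart = λ _ j e → 0≢ₘ1 (+-cancelˡ-≡ₘ (toℕ j)
        (trans (cong (_% p) (+-identityʳ (toℕ j)))
               (trans (*-cancelʳ-≡ₘ pr (0<toℕ⇒∤ b b>0) e) (toℕ-⟦⟧-≡ₘ (toℕ j + 1))))) }

  swapDesign : ∀ {X Y a} → a ∈ₛ X → ∀ {b} → b ∈ₛ Y → 0 < toℕ b → Design X Y
  swapDesign {X} {a = a} a∈X {b} b∈Y b>0 = record
    { width = ∣ X - a ∣ ; total = λ j → others j ⊕ toℕ a
    ; total-injective = λ e → enum-injective (X - a) (⊕-cancelʳ (toℕ a) e)
    ; left = λ { false → others ; true _ → a }
    ; right = λ { false _ → a ; true → others }
    ; left∈ = λ { false → others∈X ; true _ → a∈X }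
    ; right∈ = λ { false _ → a∈X ; true → others∈X }
    ; left⊕right = λ { false j → refl ; true j → cong ⟦_⟧ (+-comm (toℕ a) (toℕ (others j))) }
    ; β = b ; β∈ = b∈Y ; flexible = true
    ; flexible-apart = λ _ j e →
        x∉p-x X a (subst (_∈ₛ X - a) (toℕ-≡ₘ-injective (*-cancelʳ-≡ₘ pr (0<toℕ⇒∤ b b>0) e))
                                     (enum-∈ (X - a) j)) }
    where
    others : Fin ∣ X - a ∣ → Fp
    others = enum (X - a)
    others∈X : ∀ j → others j ∈ₛ X
    others∈X j = p─q⊆p X ⁅ a ⁆ (enum-∈ (X - a) j)

  -- For x* ∈ X with x* + (a′ − a) ∉ X, the sum x* + a′ is not of the form x + a with x ∈ X.
  module _ {X Y : Subset p} {a a′} (a∈X : a ∈ₛ X) (a′∈X-a : a′ ∈ₛ X - a) (∣X∣<p : ∣ X ∣ < p) where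

    private
      s : ℕ
      s = toℕ a′ + neg (toℕ a)

      a≢ₘa′ : ¬ toℕ a ≡ₘ toℕ a′
      a≢ₘa′ e = x∉p-x X a (subst (_∈ₛ X - a) (sym (toℕ-≡ₘ-injective e)) a′∈X-a)

      escape : ∃ λ x → x ∈ₛ X × x ⊕ s ∉ₛ X
      escape = ⊕-escapes (_∈ₛ X) (_∈? X) a∈X (proj₂ (∣p∣<n⇒∉ ∣X∣<p)) (a≢ₘa′ ∘ ∣+neg⇒≡ₘ)

      x* : Fp
      x* = proj₁ escape

      lefts rights totals : Fin (suc ∣ X ∣) → Fp
      lefts = x* ◂ enum X
      rights = a′ ◂ λ _ → a
      totals = x* ⊕ toℕ a′ ◂ λ j → enum X j ⊕ toℕ a

      lefts∈X : ∀ j → lefts j ∈ₛ X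
      lefts∈X zero = proj₁ (proj₂ escape)
      lefts∈X (suc j) = enum-∈ X j

      rights∈X : ∀ j → rights j ∈ₛ X
      rights∈X zero = p─q⊆p X ⁅ a ⁆ a′∈X-a
      rights∈X (suc j) = a∈X

      x*⊕a′-new : ∀ j → enum X j ⊕ toℕ a ≢ x* ⊕ toℕ a′
      x*⊕a′-new j e = proj₂ (proj₂ escape) (subst (_∈ₛ X) x≡x*⊕s (enum-∈ X j))
        where
        x≡x*⊕s : enum X j ≡ x* ⊕ s
        x≡x*⊕s = begin
          enum X j                        ≡⟨ ⊕-neg (enum X j) (toℕ a) ⟨
          enum X j ⊕ toℕ a ⊕ neg (toℕ a)  ≡⟨ cong (_⊕ neg (toℕ a)) e ⟩
          x* ⊕ toℕ a′ ⊕ neg (toℕ a)       ≡⟨ ⊕-assoc x* (toℕ a′) (neg (toℕ a)) ⟩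
          x* ⊕ s                          ∎
          where open ≡-Reasoning

    extraDesign : ∀ {b} → b ∈ₛ Y → Design X Y
    extraDesign {b} b∈Y = record
      { width = suc ∣ X ∣ ; total = totals
      ; total-injective = ◂-injective (λ e → enum-injective X (⊕-cancelʳ (toℕ a) e)) x*⊕a′-new
      ; left = λ _ → lefts ; right = λ _ → rights
      ; left∈ = λ _ → lefts∈X ; right∈ = λ _ → rights∈X
      ; left⊕right = λ { _ zero → refl ; _ (suc j) → refl }
      ; β = b ; β∈ = b∈Y ; flexible = false ; flexible-apart = λ () }

  -- Classifying coordinates

  data Shape (X Y : Subset p) : Set where
    full : ∣ X ∣ ≡ p → ∀ {b} → b ∈ₛ Y → 0 < toℕ b → Shape X Y
    partial : ∀ {a a′} → a ∈ₛ X → a′ ∈ₛ X - a → ∣ X ∣ < p → ∀ {b} → b ∈ₛ Y → 0 < toℕ b → Shape X Y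
    thin : ∣ X ∣ * ∣ Y ∣ ≤ p → Shape X Y

  shape : (X Y : Subset p) → Shape X Y
  shape X Y with any? (λ b → b ∈? Y ×-dec 0 <? toℕ b)
  ... | no ∄b = thin (subst (∣ X ∣ * ∣ Y ∣ ≤_) (*-identityʳ p) (*-mono-≤ (∣p∣≤n X) (⊆⁅x⁆⇒∣p∣≤1 ⟦ 0 ⟧ Y⊆0)))
    where
    Y⊆0 : ∀ {y} → y ∈ₛ Y → y ≡ ⟦ 0 ⟧
    Y⊆0 {y} y∈Y = toℕ-injective (trans (n≤0⇒n≡0 (≮⇒≥ λ y>0 → ∄b (y , y∈Y , y>0))) (sym toℕ-⟦0⟧))
  ... | yes (b , b∈Y , b>0) with 1 <? ∣ X ∣
  ...   | no ∣X∣≯1 = thin (subst (∣ X ∣ * ∣ Y ∣ ≤_) (*-identityˡ p) (*-mono-≤ (≮⇒≥ ∣X∣≯1) (∣p∣≤n Y)))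
  ...   | yes 1<∣X∣ with 0<∣p∣⇒nonempty (<-trans z<s 1<∣X∣)
  ...     | a , a∈X with 0<∣p∣⇒nonempty {S = X - a} (≤-pred (≤-trans 1<∣X∣ (∣p∣≤1+∣p-x∣ X a)))
  ...       | _ , a′∈X-a with ∣ X ∣ ≟ p
  ...         | yes ∣X∣≡p = full ∣X∣≡p b∈Y b>0
  ...         | no ∣X∣≢p = partial a∈X a′∈X-a (≤∧≢⇒< (∣p∣≤n X) ∣X∣≢p) b∈Y b>0

  isFull isPartial : ∀ {X Y} → Shape X Y → Bool
  isFull (full _ _ _) = true
  isFull _ = false
  isPartial (partial _ _ _ _ _) = true
  isPartial _ = false

  rank : ∀ {X Y} → Shape X Y → ℕ
  rank s = (if isFull s then 1 else 0) + (if isPartial s then 1 else 0)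

  ∣X∣*∣Y∣≤p^2 : (X Y : Subset p) → ∣ X ∣ * ∣ Y ∣ ≤ p ^ 2
  ∣X∣*∣Y∣≤p^2 X Y = *-mono-≤ (∣p∣≤n X) (subst (∣ Y ∣ ≤_) (sym (*-identityʳ p)) (∣p∣≤n Y))

  ∣X∣*∣Y∣≤p^[1+rank] : ∀ {X Y} (s : Shape X Y) → ∣ X ∣ * ∣ Y ∣ ≤ p ^ suc (rank s)
  ∣X∣*∣Y∣≤p^[1+rank] {X} {Y} (full _ _ _) = ∣X∣*∣Y∣≤p^2 X Y
  ∣X∣*∣Y∣≤p^[1+rank] {X} {Y} (partial _ _ _ _ _) = ∣X∣*∣Y∣≤p^2 X Y
  ∣X∣*∣Y∣≤p^[1+rank] {X} {Y} (thin ∣X∣*∣Y∣≤p) = subst (∣ X ∣ * ∣ Y ∣ ≤_) (sym (*-identityʳ p)) ∣X∣*∣Y∣≤p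

  module _ {X Y : Subset p} (X-ne : Nonempty X) (Y-ne : Nonempty Y) where

    fullCaseDesign : Shape X Y → Design X Y
    fullCaseDesign (full ∣X∣≡p b∈Y b>0) = shiftDesign ∣X∣≡p b∈Y b>0
    fullCaseDesign (partial _ _ _ _ _) = plainDesign X-ne Y-ne
    fullCaseDesign (thin _) = plainDesign X-ne Y-ne

    fullCaseDesign-flexible : ∀ s → flexible (fullCaseDesign s) ≡ isFull s
    fullCaseDesign-flexible (full _ _ _) = refl
    fullCaseDesign-flexible (partial _ _ _ _ _) = refl
    fullCaseDesign-flexible (thin _) = refl

    fullCaseDesign-width : ∀ s → ∣ X ∣ ≤ width (fullCaseDesign s)
    fullCaseDesign-width (full _ _ _) = ∣p∣≤n X
    fullCaseDesign-width (partial _ _ _ _ _) = ≤-refl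
    fullCaseDesign-width (thin _) = ≤-refl

    partialCaseRole : Bool → Shape X Y → Role
    partialCaseRole c (full _ _ _) = plain
    partialCaseRole c (thin _) = plain
    partialCaseRole c (partial _ _ _ _ _) = if c then lossy else gain

    partialCaseDesign : Bool → Shape X Y → Design X Y
    partialCaseDesign c (full _ _ _) = plainDesign X-ne Y-ne
    partialCaseDesign c (thin _) = plainDesign X-ne Y-ne
    partialCaseDesign true (partial a∈X _ _ b∈Y b>0) = swapDesign a∈X b∈Y b>0
    partialCaseDesign false (partial a∈X a′∈X-a ∣X∣<p b∈Y _) = extraDesign a∈X a′∈X-a ∣X∣<p b∈Y

    partialCaseDesign-fits : ∀ c s → Fits p (partialCaseRole c s) ∣ X ∣ (width (partialCaseDesign c s))
    partialCaseDesign-fits c (full _ _ _) = ≤-refl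
    partialCaseDesign-fits c (thin _) = ≤-refl
    partialCaseDesign-fits true (partial {a = a} _ a′∈X-a _ _ _) =
      ≤-trans (∣p∣≤1+∣p-x∣ X a) (subst (suc m ≤_) (cong (m +_) (sym (+-identityʳ m))) (+-monoˡ-≤ m 0<m))
      where
      m = ∣ X - a ∣
      0<m = ∈⇒0<∣p∣ a′∈X-a
    partialCaseDesign-fits false (partial _ _ _ _ _) = ≤-refl , ∣p∣≤n X

    partialCaseDesign-flexible : ∀ c s → flexible (partialCaseDesign c s) ≡ isLossy (partialCaseRole c s)
    partialCaseDesign-flexible c (full _ _ _) = refl
    partialCaseDesign-flexible c (thin _) = refl
    partialCaseDesign-flexible true (partial _ _ _ _ _) = refl
    partialCaseDesign-flexible false (partial _ _ _ _ _) = refl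

    partialCaseRole-lossy : ∀ c s → isLossy (partialCaseRole c s) ≡ isPartial s ∧ c
    partialCaseRole-lossy c (full _ _ _) = refl
    partialCaseRole-lossy c (thin _) = refl
    partialCaseRole-lossy true (partial _ _ _ _ _) = refl
    partialCaseRole-lossy false (partial _ _ _ _ _) = refl

    partialCaseRole-gain : ∀ c s → isGain (partialCaseRole c s) ≡ isPartial s ∧ not c
    partialCaseRole-gain c (full _ _ _) = refl
    partialCaseRole-gain c (thin _) = refl
    partialCaseRole-gain true (partial _ _ _ _ _) = refl
    partialCaseRole-gain false (partial _ _ _ _ _) = refl

  p^[n+M]-bound : ∀ {n M S} a b → 2 * M + 1 ≤ n → S ≤ p ^ (n + M) → S ^ (4 * b) ≤ order n ^ (3 * b + 4 * a)
  p^[n+M]-bound {n} {M} {S} a b n≥2M+1 S≤ = begin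
    S ^ (4 * b)                          ≤⟨ ^-monoˡ-≤ (4 * b) S≤ ⟩
    (p ^ (n + M)) ^ (4 * b)              ≡⟨ ^-*-assoc p (n + M) (4 * b) ⟩
    p ^ ((n + M) * (4 * b))              ≤⟨ ^-monoʳ-≤ p exponents ⟩
    p ^ ((2 * n + 1) * (3 * b + 4 * a))  ≡⟨ ^-*-assoc p (2 * n + 1) (3 * b + 4 * a) ⟨
    order n ^ (3 * b + 4 * a)            ∎
    where
    open ≤-Reasoning
    t = proj₁ (m≤n⇒∃[o]m+o≡n n≥2M+1)
    expand : ∀ M t → (2 * M + 1 + t + M) * 4 + (5 + 2 * t) ≡ (2 * (2 * M + 1 + t) + 1) * 3
    expand = solve 2 (λ M t → (con 2 :* M :+ con 1 :+ t :+ M) :* con 4 :+ (con 5 :+ con 2 :* t)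
                            := (con 2 :* (con 2 :* M :+ con 1 :+ t) :+ con 1) :* con 3) refl
      where open +-*-Solver
    per-unit : (n + M) * 4 ≤ (2 * n + 1) * 3
    per-unit = subst (λ n → (n + M) * 4 ≤ (2 * n + 1) * 3) (proj₂ (m≤n⇒∃[o]m+o≡n n≥2M+1))
                     (≤-trans (m≤m+n _ (5 + 2 * t)) (≤-reflexive (expand M t)))
    exponents : (n + M) * (4 * b) ≤ (2 * n + 1) * (3 * b + 4 * a)
    exponents = begin
      (n + M) * (4 * b)              ≡⟨ *-assoc (n + M) 4 b ⟨
      (n + M) * 4 * b                ≤⟨ *-monoˡ-≤ b per-unit ⟩
      (2 * n + 1) * 3 * b            ≡⟨ *-assoc (2 * n + 1) 3 b ⟩
      (2 * n + 1) * (3 * b)          ≤⟨ *-monoʳ-≤ (2 * n + 1) (m≤m+n (3 * b) (4 * a)) ⟩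
      (2 * n + 1) * (3 * b + 4 * a)  ∎

  -- M bounds 1 + #full + #partial when neither the full nor the partial case applies.
  M : ℕ
  M = p + (p + p * 2 ^ p)

  n₀ : ℕ
  n₀ = 2 * M + 1

  module Cases {n} (k : Kind) (B : Brick n) where

    shapes : (i : Fin n) → Shape (X B i) (Y B i)
    shapes i = shape (X B i) (Y B i)

    Full Partial : Fin n → Bool
    Full i = isFull (shapes i)
    Partial i = isPartial (shapes i)

    Conclusion : Set
    Conclusion = Σ ℕ λ m → (size B ≤ m * p) × ContainsCosets k B m

    fromDesigns : (D : ∀ i → Design (X B i) (Y B i)) → p ≤ count (flexible ∘ D) →
                  prodF (λ i → ∣ X B i ∣) ≤ prodF (width ∘ D) → Conclusion
    fromDesigns D p≤flexible widths =
      prodF (Cosets.cells k B D) , Cosets.size≤ k B D widths , Cosets.containsCosets k B D p≤flexible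

    manyFull : p ≤ count Full → Conclusion
    manyFull p≤Full = fromDesigns D
      (subst (p ≤_) (sym (count-cong λ i → fullCaseDesign-flexible (X-ne B i) (Y-ne B i) (shapes i))) p≤Full)
      (prodF-mono λ i → fullCaseDesign-width (X-ne B i) (Y-ne B i) (shapes i))
      where
      D : ∀ i → Design (X B i) (Y B i)
      D i = fullCaseDesign (X-ne B i) (Y-ne B i) (shapes i)

    manyPartial : p + p * 2 ^ p ≤ count Partial → Conclusion
    manyPartial enough = fromDesigns D (≤-reflexive (sym flexible-count)) widths
      where
      chosen : Fin n → Bool
      chosen = first p Partial

      D : ∀ i → Design (X B i) (Y B i)
      D i = partialCaseDesign (X-ne B i) (Y-ne B i) (chosen i) (shapes i)

      role : Fin n → Role
      role i = partialCaseRole (X-ne B i) (Y-ne B i) (chosen i) (shapes i)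

      lossy-count : count (isLossy ∘ role) ≡ p
      lossy-count = trans (count-cong λ i → partialCaseRole-lossy (X-ne B i) (Y-ne B i) (chosen i) (shapes i))
                          (trans (count-first p Partial) (m≤n⇒m⊓n≡m (≤-trans (m≤m+n p _) enough)))

      gain-count : count (isGain ∘ role) ≡ count Partial ∸ p
      gain-count = trans (count-cong λ i → partialCaseRole-gain (X-ne B i) (Y-ne B i) (chosen i) (shapes i))
                         (count-¬first p Partial)

      flexible-count : count (flexible ∘ D) ≡ p
      flexible-count =
        trans (count-cong λ i → partialCaseDesign-flexible (X-ne B i) (Y-ne B i) (chosen i) (shapes i)) lossy-count

      p2^p≤p+gain : p * 2 ^ p ≤ p + count (isGain ∘ role)
      p2^p≤p+gain = begin
        p * 2 ^ p                  ≡⟨ m+n∸m≡n p (p * 2 ^ p) ⟨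
        p + p * 2 ^ p ∸ p          ≤⟨ ∸-monoˡ-≤ p enough ⟩
        count Partial ∸ p          ≡⟨ gain-count ⟨
        count (isGain ∘ role)      ≤⟨ m≤n+m _ p ⟩
        p + count (isGain ∘ role)  ∎
        where open ≤-Reasoning

      widths : prodF (λ i → ∣ X B i ∣) ≤ prodF (width ∘ D)
      widths = *-cancelˡ-≤ (p * 2 ^ p) {{m*n≢0 p (2 ^ p) {{p≢0}} {{m^n≢0 2 p}}}} (begin
        p * 2 ^ p * prodF (λ i → ∣ X B i ∣)                    ≤⟨ *-monoˡ-≤ _ p2^p≤p+gain ⟩
        (p + count (isGain ∘ role)) * prodF (λ i → ∣ X B i ∣)  ≤⟨ tradeoff p _ _ role fits ⟩
        p * 2 ^ count (isLossy ∘ role) * prodF (width ∘ D)     ≡⟨ cong (λ L → p * 2 ^ L * prodF (width ∘ D)) lossy-count ⟩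
        p * 2 ^ p * prodF (width ∘ D)                          ∎)
        where
        open ≤-Reasoning
        fits : ∀ i → Fits p (role i) ∣ X B i ∣ (width (D i))
        fits i = partialCaseDesign-fits (X-ne B i) (Y-ne B i) (chosen i) (shapes i)

    size≤p^[n+M] : count Full < p → count Partial < p + p * 2 ^ p → size B ≤ p ^ (n + M)
    size≤p^[n+M] Full<p Partial<p+p2^p = begin
      prodF (λ i → ∣ X B i ∣) * prodF (λ i → ∣ Y B i ∣) * ∣ Z B ∣
        ≤⟨ *-mono-≤ (≤-reflexive (sym (prodF-* (λ i → ∣ X B i ∣) (λ i → ∣ Y B i ∣)))) (∣p∣≤n (Z B)) ⟩
      prodF (λ i → ∣ X B i ∣ * ∣ Y B i ∣) * p
        ≤⟨ *-monoˡ-≤ p (prodF-≤-^ p _ (rank ∘ shapes) (∣X∣*∣Y∣≤p^[1+rank] ∘ shapes)) ⟩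
      p ^ (n + R) * p
        ≡⟨ *-comm (p ^ (n + R)) p ⟩
      p ^ suc (n + R)
        ≤⟨ ^-monoʳ-≤ p (subst (_≤ n + M) (+-suc n R) (+-monoʳ-≤ n 1+R≤M)) ⟩
      p ^ (n + M) ∎
      where
      open ≤-Reasoning
      R = sum (rank ∘ shapes)
      R≡ : R ≡ count Full + count Partial
      R≡ = ∑-distrib-+ (λ i → if Full i then 1 else 0) (λ i → if Partial i then 1 else 0)
      1+R≤M : suc R ≤ M
      1+R≤M = subst (λ r → suc r ≤ M) (sym R≡) (+-mono-≤ Full<p (<⇒≤ Partial<p+p2^p))

    conclusion : n₀ ≤ n → ∀ a b → BigBrick B a b → Conclusion
    conclusion n₀≤n a b big with p ≤? count Full
    ... | yes p≤Full = manyFull p≤Full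
    ... | no p≰Full with p + p * 2 ^ p ≤? count Partial
    ...   | yes enough = manyPartial enough
    ...   | no ¬enough =
      contradiction (p^[n+M]-bound a b n₀≤n (size≤p^[n+M] (≰⇒> p≰Full) (≰⇒> ¬enough))) (<⇒≱ big)

-- The hypotheses 0 < a and 0 < b are unused: for n ≥ n₀ the remaining case already forces |B| ≤ |G|^(3/4).
theorem1p3 : (p : ℕ) (pr : Prime p) (a b : ℕ) → 0 < a → 0 < b →
    Σ ℕ λ n₀ → (n : ℕ) → n₀ ≤ n → (k : Kind) (B : ES.Brick p pr n) →
      ES.BigBrick p pr B a b →
      Σ ℕ λ m → (ES.size p pr B ≤ m * p) × ES.ContainsCosets p pr k B m
theorem1p3 p pr a b _ _ = n₀ , λ n n₀≤n k B big → Cases.conclusion k B n₀≤n a b big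
  where open Extraspecial p pr
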